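{- Let $r$ be odd and suppose that $H$ is an intersecting $r$-partite hypergraph with $|H|\le r$ and $\tau(H)\ge(r+1)/2$. Then: $|H|=r$; $\tau(H)=(r+1)/2$; each side of $H$ consists of one vertex of degree $1$ and $(r-1)/2$ vertices of degree $2$; each edge of $H$ contains one vertex of degree $1$ and $r-1$ vertices of degree $2$; and $H$ is linear.
   Context: $|H|$ denotes the number of edges of $H$. A hypergraph is $r$-partite if its vertex set can be partitioned into $r$ sets (the sides) so that every edge contains exactly one vertex from each side. $H$ is intersecting if every two edges share a vertex; an intersecting hypergraph is linear if every two distinct edges meet in exactly one vertex. The covering number $\tau(H)$ is the minimum size of a set of vertices meeting every edge. -}

module Defs where

open import Data.Nat using (ℕ; zero; suc; _+_; _≤_)
open import Data.Fin using (Fin; zero; suc; _≟_)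
open import Data.Fin.Subset using (Subset; _∈_; ∣_∣)
open import Data.Product using (Σ; ∃; _×_; _,_)
open import Relation.Nullary using (Dec; yes; no; ¬_)
open import Relation.Binary.PropositionalEquality using (_≡_)

count : ∀ {m} (P : Fin m → Set) → ((j : Fin m) → Dec (P j)) → ℕ
count {zero}  P P? = 0
count {suc m} P P? with P? zero
... | yes _ = suc (count (λ j → P (suc j)) (λ j → P? (suc j)))
... | no  _ = count (λ j → P (suc j)) (λ j → P? (suc j))

sumFin : ∀ {r} → (Fin r → ℕ) → ℕ
sumFin {zero}  f = 0
sumFin {suc r} f = f zero + sumFin (λ i → f (suc i))

-- Side i has vertex set Fin (n i); vertices of distinct sides are distinct.
-- Edges are distinct (a hypergraph is a set of edges).
record Partite (r : ℕ) : Set where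
  field
    n     : Fin r → ℕ
    m     : ℕ
    edge  : Fin m → (i : Fin r) → Fin (n i)
    distinct : ∀ j j' → (∀ i → edge j i ≡ edge j' i) → j ≡ j'
open Partite public

size : ∀ {r} → Partite r → ℕ
size H = m H

deg : ∀ {r} (H : Partite r) (i : Fin r) → Fin (n H i) → ℕ
deg H i v = count (λ j → edge H j i ≡ v) (λ j → edge H j i ≟ v)

Intersecting : ∀ {r} → Partite r → Set
Intersecting H = ∀ j j' → ∃ λ i → edge H j i ≡ edge H j' i

Linear : ∀ {r} → Partite r → Set
Linear H = ∀ j j' → ¬ (j ≡ j') →
  count (λ i → edge H j i ≡ edge H j' i) (λ i → edge H j i ≟ edge H j' i) ≡ 1

VertexSet : ∀ {r} → Partite r → Set
VertexSet {r} H = (i : Fin r) → Subset (n H i)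

vsSize : ∀ {r} (H : Partite r) → VertexSet H → ℕ
vsSize H C = sumFin (λ i → ∣_∣ {n H i} (C i))

IsCover : ∀ {r} (H : Partite r) → VertexSet H → Set
IsCover H C = ∀ j → ∃ λ i → _∈_ {n = n H i} (edge H j i) (C i)

CoveringNumber : ∀ {r} → Partite r → ℕ → Set
CoveringNumber H t =
  (Σ (VertexSet H) λ C → IsCover H C × vsSize H C ≡ t) ×
  (∀ C → IsCover H C → t ≤ vsSize H C)

CoveringNumberAtLeast : ∀ {r} → Partite r → ℕ → Set
CoveringNumberAtLeast H t = ∀ C → IsCover H C → t ≤ vsSize H C

-- Two ingredients. (1) Covering: in an intersecting hypergraph any s edges
-- are covered by ⌈s/2⌉ vertices (pair them up and take a common vertex of
-- each pair). With τ ≥ k+1 this forces |H| ≥ 2k+1, hence |H| = r and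
-- τ = k+1, and also every degree is ≤ 2 (a vertex of degree ≥ 3 plus a
-- half-cover of the remaining ≤ 2k-2 edges would be a cover of size ≤ k).
-- (2) Double counting: Σ_e Σ_{v∈e} d(v) = Σ_sides Σ_v d(v)². The inner sum
-- on the left is Σ_f |e ∩ f| ≥ r + (|H|-1) = 4k+1, since H is intersecting;
-- on the right, degrees in {0,1,2} summing to |H| = 2k+1 give Σ d² ≤ 4k+1.
-- Both sides have r terms, so every inequality is tight, and reading off
-- the equality cases gives the degree profiles and linearity.
module Submission where

open import Defs
open import Data.Nat using (ℕ; zero; suc; _+_; _*_; _≤_; _≥_; z≤n; s≤s; _≟_)
open import Data.Nat.Properties
open import Data.Bool using (true; false; if_then_else_)
open import Data.Vec using (_∷_; [])
open import Data.Fin using (Fin; zero; suc) renaming (_≟_ to _≟ᶠ_)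
open import Data.Fin.Subset using (Subset; _∪_; ∣_∣; ⁅_⁆) renaming (⊥ to ∅; _∈_ to _∈ₛ_)
open import Data.Fin.Subset.Properties using (∣⊥∣≡0; ∣⁅x⁆∣≡1; x∈⁅x⁆; p⊆p∪q; q⊆p∪q)
open import Data.List using (List; []; _∷_; length; map; foldr)
open import Data.List.Properties using (length-map)
open import Data.List.Membership.Propositional using (_∈_)
open import Data.List.Membership.Propositional.Properties using (∈-map⁺)
open import Data.List.Relation.Unary.All as All using (All; []; _∷_)
open import Data.List.Relation.Unary.Any using (Any; here; there)
open import Data.Product using (Σ; ∃; _×_; _,_; proj₁; proj₂)
open import Data.Sum using (_⊎_; inj₁; inj₂)
open import Data.Empty using (⊥-elim)
open import Data.Unit using (⊤; tt)
open import Function using (_∘_)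
open import Relation.Nullary using (Dec; yes; no; ¬_; does)
open import Relation.Nullary.Decidable using (¬?)
open import Relation.Binary.PropositionalEquality
open import Algebra.Properties.Semiring.Sum +-*-semiring
  using (sum; sum-syntax; sum-cong-≗; ∑-distrib-+; ∑-comm; *-distribˡ-sum; *-distribʳ-sum)
import Data.Nat
open import Data.Nat.Tactic.RingSolver using (solve-∀)

sumFin≡∑ : ∀ {n} (f : Fin n → ℕ) → sumFin f ≡ ∑[ i < n ] f i
sumFin≡∑ {zero}  f = refl
sumFin≡∑ {suc n} f = cong (f zero +_) (sumFin≡∑ (f ∘ suc))

∑-const : ∀ n c → ∑[ i < n ] c ≡ n * c
∑-const zero    c = refl
∑-const (suc n) c = cong (c +_) (∑-const n c)

∑-zero : ∀ n → ∑[ i < n ] 0 ≡ 0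
∑-zero n = trans (∑-const n 0) (*-zeroʳ n)

∑-mono : ∀ {n} {f g : Fin n → ℕ} → (∀ x → f x ≤ g x) → sum f ≤ sum g
∑-mono {zero}  f≤g = z≤n
∑-mono {suc n} f≤g = +-mono-≤ (f≤g zero) (∑-mono (f≤g ∘ suc))

term≤∑ : ∀ {n} (f : Fin n → ℕ) x → f x ≤ sum f
term≤∑ f zero    = m≤m+n (f zero) _
term≤∑ f (suc x) = ≤-trans (term≤∑ (f ∘ suc) x) (m≤n+m _ (f zero))

∑-tight : ∀ {n} {f g : Fin n → ℕ} → (∀ x → f x ≤ g x) → sum g ≤ sum f →
          ∀ x → f x ≡ g x
∑-tight {suc n} {f} {g} f≤g ∑g≤∑f = pointwise
  where
    head≡ : f zero ≡ g zero
    head≡ = ≤-antisym (f≤g zero)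
      (+-cancelʳ-≤ (sum (g ∘ suc)) (g zero) (f zero)
        (≤-trans ∑g≤∑f (+-monoʳ-≤ (f zero) (∑-mono (f≤g ∘ suc)))))
    tail≤ : sum (g ∘ suc) ≤ sum (f ∘ suc)
    tail≤ = +-cancelˡ-≤ (g zero) _ _ (subst (λ c → g zero + _ ≤ c + _) head≡ ∑g≤∑f)
    pointwise : ∀ x → f x ≡ g x
    pointwise zero    = head≡
    pointwise (suc x) = ∑-tight (f≤g ∘ suc) tail≤ x

∑-squeeze : ∀ {a b t} {f : Fin a → ℕ} {g : Fin b → ℕ} → a ≡ b →
            (∀ x → t ≤ f x) → (∀ y → g y ≤ t) → sum f ≡ sum g →
            (∀ x → f x ≡ t) × (∀ y → g y ≡ t)
∑-squeeze {a} {b} {t} {f} {g} refl t≤f g≤t ∑f≡∑g =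
  (λ x → sym (∑-tight t≤f ∑f≤∑t x)) , ∑-tight g≤t ∑t≤∑g
  where
    ∑f≤∑t : sum f ≤ ∑[ x < a ] t
    ∑f≤∑t = ≤-trans (≤-reflexive ∑f≡∑g) (∑-mono g≤t)
    ∑t≤∑g : ∑[ x < a ] t ≤ sum g
    ∑t≤∑g = ≤-trans (∑-mono t≤f) (≤-reflexive ∑f≡∑g)

𝟙 : ∀ {a} {A : Set a} → Dec A → ℕ
𝟙 d = if does d then 1 else 0

𝟙-yes : ∀ {a} {A : Set a} (d : Dec A) → A → 𝟙 d ≡ 1
𝟙-yes (yes _) _ = refl
𝟙-yes (no ¬a) a = ⊥-elim (¬a a)

𝟙-no : ∀ {a} {A : Set a} (d : Dec A) → ¬ A → 𝟙 d ≡ 0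
𝟙-no (yes a) ¬a = ⊥-elim (¬a a)
𝟙-no (no _)  _  = refl

𝟙-⇔ : ∀ {a b} {A : Set a} {B : Set b} → (A → B) → (B → A) →
      (d : Dec A) (e : Dec B) → 𝟙 d ≡ 𝟙 e
𝟙-⇔ A→B B→A (yes a) (yes b) = refl
𝟙-⇔ A→B B→A (yes a) (no ¬b) = ⊥-elim (¬b (A→B a))
𝟙-⇔ A→B B→A (no ¬a) (yes b) = ⊥-elim (¬a (B→A b))
𝟙-⇔ A→B B→A (no ¬a) (no ¬b) = refl

count≡∑𝟙 : ∀ {m} (P : Fin m → Set) (P? : ∀ j → Dec (P j)) →
           count P P? ≡ ∑[ j < m ] 𝟙 (P? j)
count≡∑𝟙 {zero}  P P? = refl
count≡∑𝟙 {suc m} P P? with P? zero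
... | yes _ = cong suc (count≡∑𝟙 _ (P? ∘ suc))
... | no  _ = count≡∑𝟙 _ (P? ∘ suc)

count-all : ∀ {m} (P : Fin m → Set) (P? : ∀ j → Dec (P j)) → (∀ j → P j) →
            count P P? ≡ m
count-all {m} P P? all = begin
  count P P?            ≡⟨ count≡∑𝟙 P P? ⟩
  ∑[ j < m ] 𝟙 (P? j)   ≡⟨ sum-cong-≗ (λ j → 𝟙-yes (P? j) (all j)) ⟩
  ∑[ j < m ] 1          ≡⟨ ∑-const m 1 ⟩
  m * 1                 ≡⟨ *-identityʳ m ⟩
  m                     ∎
  where open ≡-Reasoning

count-pos : ∀ {m} (P : Fin m → Set) (P? : ∀ j → Dec (P j)) j → P j →
            1 ≤ count P P?
count-pos P P? j pj = begin
  1                    ≡⟨ 𝟙-yes (P? j) pj ⟨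
  𝟙 (P? j)             ≤⟨ term≤∑ (𝟙 ∘ P?) j ⟩
  sum (𝟙 ∘ P?)         ≡⟨ count≡∑𝟙 P P? ⟨
  count P P?           ∎
  where open ≤-Reasoning

count-compl : ∀ {m} (P : Fin m → Set) (P? : ∀ j → Dec (P j)) →
              count P P? + count (¬_ ∘ P) (¬? ∘ P?) ≡ m
count-compl {zero}  P P? = refl
count-compl {suc m} P P? with P? zero
... | yes _ = cong suc (count-compl _ (P? ∘ suc))
... | no  _ = trans (+-suc _ _) (cong suc (count-compl _ (P? ∘ suc)))

∑-select : ∀ {n} (x : Fin n) (g : Fin n → ℕ) → ∑[ v < n ] (𝟙 (x ≟ᶠ v) * g v) ≡ g x
∑-select {suc n} zero    g =
  trans (cong (1 * g zero +_) (∑-zero n)) (trans (+-identityʳ _) (*-identityˡ _))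
∑-select {suc n} (suc x) g = ∑-select x (g ∘ suc)

∑-fibres : ∀ {m n} (x : Fin m → Fin n) (g : Fin n → ℕ) →
           ∑[ j < m ] g (x j) ≡ ∑[ v < n ] (count (λ j → x j ≡ v) (λ j → x j ≟ᶠ v) * g v)
∑-fibres {m} {n} x g = sym (begin
  ∑[ v < n ] (count (λ j → x j ≡ v) (λ j → x j ≟ᶠ v) * g v)
    ≡⟨ sum-cong-≗ (λ v → cong (_* g v) (count≡∑𝟙 _ (λ j → x j ≟ᶠ v))) ⟩
  ∑[ v < n ] (∑[ j < m ] 𝟙 (x j ≟ᶠ v) * g v)
    ≡⟨ sum-cong-≗ (λ v → *-distribʳ-sum (g v) (λ j → 𝟙 (x j ≟ᶠ v))) ⟩
  ∑[ v < n ] ∑[ j < m ] (𝟙 (x j ≟ᶠ v) * g v)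
    ≡⟨ ∑-comm (λ j v → 𝟙 (x j ≟ᶠ v) * g v) ⟨
  ∑[ j < m ] ∑[ v < n ] (𝟙 (x j ≟ᶠ v) * g v)
    ≡⟨ sum-cong-≗ (λ j → ∑-select (x j) g) ⟩
  ∑[ j < m ] g (x j) ∎)
  where open ≡-Reasoning

double-suc : ∀ c → suc (2 * c + 1) ≡ 2 * suc c
double-suc = solve-∀

half≤ : ∀ a c → 2 * a ≤ 2 * c + 1 → a ≤ c
half≤ a c 2a≤ =
  m<1+n⇒m≤n (*-cancelˡ-< 2 a (suc c) (≤-trans (s≤s 2a≤) (≤-reflexive (double-suc c))))

side-arith : ∀ k a b → a + 2 * b ≡ 2 * k + 1 → (2 * k + 1) + 2 * b ≡ (2 * k + 1) + 2 * k →
             a ≡ 1 × b ≡ k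
side-arith k a b sum≡ squares≡ = a≡1 , b≡k
  where
    b≡k : b ≡ k
    b≡k = *-cancelˡ-≡ b k 2 (+-cancelˡ-≡ (2 * k + 1) _ _ squares≡)
    a≡1 : a ≡ 1
    a≡1 = +-cancelʳ-≡ (2 * k) a 1
      (trans (cong (λ c → a + 2 * c) (sym b≡k)) (trans sum≡ (+-comm (2 * k) 1)))

edge-arith : ∀ k a b → a + b ≡ 2 * k + 1 → a + 2 * b ≡ (2 * k + 1) + 2 * k →
             a ≡ 1 × b ≡ 2 * k
edge-arith k a b count≡ sum≡ = a≡1 , b≡2k
  where
    regroup : ∀ a b → (a + b) + b ≡ a + 2 * b
    regroup = solve-∀
    b≡2k : b ≡ 2 * k
    b≡2k = +-cancelˡ-≡ (2 * k + 1) b (2 * k)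
      (trans (cong (_+ b) (sym count≡)) (trans (regroup a b) sum≡))
    a≡1 : a ≡ 1
    a≡1 = +-cancelʳ-≡ (2 * k) a 1
      (trans (cong (a +_) (sym b≡2k)) (trans count≡ (+-comm (2 * k) 1)))

between-1-2 : ∀ {c} → 1 ≤ c → c ≤ 2 → c ≡ 1 ⊎ c ≡ 2
between-1-2 (s≤s z≤n) (s≤s z≤n)       = inj₁ refl
between-1-2 (s≤s z≤n) (s≤s (s≤s z≤n)) = inj₂ refl

fibreSize : ∀ {n} → (Fin n → ℕ) → ℕ → ℕ
fibreSize d c = count (λ x → d x ≡ c) (λ x → d x ≟ c)

module ValuesUpTo2 {n} (d : Fin n → ℕ) (d≤2 : ∀ x → d x ≤ 2) where

  private
    #1 #2 : ℕ
    #1 = fibreSize d 1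
    #2 = fibreSize d 2

    asIndicators : ∀ c → c ≤ 2 → c ≡ 𝟙 (c ≟ 1) + 2 * 𝟙 (c ≟ 2)
    asIndicators 0 _ = refl
    asIndicators 1 _ = refl
    asIndicators 2 _ = refl
    asIndicators (suc (suc (suc _))) (s≤s (s≤s ()))

    square : ∀ c → c ≤ 2 → c * c ≡ c + 2 * 𝟙 (c ≟ 2)
    square 0 _ = refl
    square 1 _ = refl
    square 2 _ = refl
    square (suc (suc (suc _))) (s≤s (s≤s ()))

    oneOrTwo : ∀ c → 1 ≤ c → c ≤ 2 → 𝟙 (c ≟ 1) + 𝟙 (c ≟ 2) ≡ 1
    oneOrTwo 1 _ _ = refl
    oneOrTwo 2 _ _ = refl
    oneOrTwo (suc (suc (suc _))) _ (s≤s (s≤s ()))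

    ∑2·𝟙 : 2 * #2 ≡ ∑[ x < n ] (2 * 𝟙 (d x ≟ 2))
    ∑2·𝟙 = trans (cong (2 *_) (count≡∑𝟙 _ (λ x → d x ≟ 2))) (*-distribˡ-sum {n} 2 _)

  ∑-values : sum d ≡ #1 + 2 * #2
  ∑-values = begin
    sum d                                              ≡⟨ sum-cong-≗ (λ x → asIndicators (d x) (d≤2 x)) ⟩
    ∑[ x < n ] (𝟙 (d x ≟ 1) + 2 * 𝟙 (d x ≟ 2))         ≡⟨ ∑-distrib-+ {n} _ _ ⟩
    ∑[ x < n ] 𝟙 (d x ≟ 1) + ∑[ x < n ] (2 * 𝟙 (d x ≟ 2))
      ≡⟨ cong₂ _+_ (count≡∑𝟙 _ (λ x → d x ≟ 1)) ∑2·𝟙 ⟨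
    #1 + 2 * #2                                        ∎
    where open ≡-Reasoning

  ∑-squares : ∑[ x < n ] (d x * d x) ≡ sum d + 2 * #2
  ∑-squares = begin
    ∑[ x < n ] (d x * d x)                             ≡⟨ sum-cong-≗ (λ x → square (d x) (d≤2 x)) ⟩
    ∑[ x < n ] (d x + 2 * 𝟙 (d x ≟ 2))                 ≡⟨ ∑-distrib-+ {n} _ _ ⟩
    sum d + ∑[ x < n ] (2 * 𝟙 (d x ≟ 2))               ≡⟨ cong (sum d +_) ∑2·𝟙 ⟨
    sum d + 2 * #2                                     ∎
    where open ≡-Reasoning

  values-cover : (∀ x → 1 ≤ d x) → #1 + #2 ≡ n
  values-cover d≥1 = begin
    #1 + #2
      ≡⟨ cong₂ _+_ (count≡∑𝟙 _ (λ x → d x ≟ 1)) (count≡∑𝟙 _ (λ x → d x ≟ 2)) ⟩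
    ∑[ x < n ] 𝟙 (d x ≟ 1) + ∑[ x < n ] 𝟙 (d x ≟ 2)    ≡⟨ ∑-distrib-+ {n} _ _ ⟨
    ∑[ x < n ] (𝟙 (d x ≟ 1) + 𝟙 (d x ≟ 2))
      ≡⟨ sum-cong-≗ (λ x → oneOrTwo (d x) (d≥1 x) (d≤2 x)) ⟩
    ∑[ x < n ] 1                                       ≡⟨ ∑-const n 1 ⟩
    n * 1                                              ≡⟨ *-identityʳ n ⟩
    n                                                  ∎
    where open ≡-Reasoning

enumerate : ∀ {m} {P : Fin m → Set} → (∀ j → Dec (P j)) → List (Fin m)
enumerate {zero}  P? = []
enumerate {suc m} P? with P? zero
... | yes _ = zero ∷ map suc (enumerate (P? ∘ suc))
... | no  _ = map suc (enumerate (P? ∘ suc))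

length-enumerate : ∀ {m} {P : Fin m → Set} (P? : ∀ j → Dec (P j)) →
                   length (enumerate P?) ≡ count P P?
length-enumerate {zero}  P? = refl
length-enumerate {suc m} P? with P? zero
... | yes _ = cong suc (trans (length-map suc (enumerate (P? ∘ suc)))
                              (length-enumerate (P? ∘ suc)))
... | no  _ = trans (length-map suc (enumerate (P? ∘ suc))) (length-enumerate (P? ∘ suc))

∈-enumerate : ∀ {m} {P : Fin m → Set} (P? : ∀ j → Dec (P j)) j → P j → j ∈ enumerate P?
∈-enumerate {suc m} P? zero p0 with P? zero
... | yes _  = here refl
... | no ¬p0 = ⊥-elim (¬p0 p0)
∈-enumerate {suc m} P? (suc j) pj with P? zero
... | yes _ = there (∈-map⁺ suc (∈-enumerate (P? ∘ suc) j pj))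
... | no  _ = ∈-map⁺ suc (∈-enumerate (P? ∘ suc) j pj)

∣p∪q∣≤∣p∣+∣q∣ : ∀ {n} (p q : Subset n) → ∣ p ∪ q ∣ ≤ ∣ p ∣ + ∣ q ∣
∣p∪q∣≤∣p∣+∣q∣ []          []          = z≤n
∣p∪q∣≤∣p∣+∣q∣ (true ∷ p)  (true ∷ q)  =
  s≤s (≤-trans (∣p∪q∣≤∣p∣+∣q∣ p q) (+-monoʳ-≤ ∣ p ∣ (n≤1+n ∣ q ∣)))
∣p∪q∣≤∣p∣+∣q∣ (true ∷ p)  (false ∷ q) = s≤s (∣p∪q∣≤∣p∣+∣q∣ p q)
∣p∪q∣≤∣p∣+∣q∣ (false ∷ p) (true ∷ q)  =
  ≤-trans (s≤s (∣p∪q∣≤∣p∣+∣q∣ p q)) (≤-reflexive (sym (+-suc ∣ p ∣ ∣ q ∣)))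
∣p∪q∣≤∣p∣+∣q∣ (false ∷ p) (false ∷ q) = ∣p∪q∣≤∣p∣+∣q∣ p q

module VertexLists {r} (H : Partite r) where

  Vertex : Set
  Vertex = Σ (Fin r) (λ i → Fin (n H i))

  _∋_ : Fin (m H) → Vertex → Set
  j ∋ (i , v) = edge H j i ≡ v

  Hits : List Vertex → Fin (m H) → Set
  Hits L j = Any (j ∋_) L

  ⁅_⁆ᵥ : Vertex → VertexSet H
  ⁅ i , v ⁆ᵥ i′ with i ≟ᶠ i′
  ... | yes refl = ⁅ v ⁆
  ... | no  _    = ∅

  _∪ᵥ_ : VertexSet H → VertexSet H → VertexSet H
  (C ∪ᵥ D) i = C i ∪ D i

  setOf : List Vertex → VertexSet H
  setOf = foldr (λ x C → ⁅ x ⁆ᵥ ∪ᵥ C) (λ i → ∅)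

  vsSize≡∑ : ∀ C → vsSize H C ≡ ∑[ i < r ] ∣ C i ∣
  vsSize≡∑ C = sumFin≡∑ {r} (λ i → ∣ C i ∣)

  size-⁅⁆ᵥ : ∀ x → vsSize H ⁅ x ⁆ᵥ ≡ 1
  size-⁅⁆ᵥ (i , v) = begin
    vsSize H ⁅ i , v ⁆ᵥ             ≡⟨ vsSize≡∑ ⁅ i , v ⁆ᵥ ⟩
    ∑[ i′ < r ] ∣ ⁅ i , v ⁆ᵥ i′ ∣   ≡⟨ sum-cong-≗ onSide ⟩
    ∑[ i′ < r ] (𝟙 (i ≟ᶠ i′) * 1)   ≡⟨ ∑-select i (λ _ → 1) ⟩
    1                               ∎
    where
      open ≡-Reasoning
      onSide : ∀ i′ → ∣ ⁅ i , v ⁆ᵥ i′ ∣ ≡ 𝟙 (i ≟ᶠ i′) * 1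
      onSide i′ with i ≟ᶠ i′
      ... | yes refl = ∣⁅x⁆∣≡1 v
      ... | no  _    = ∣⊥∣≡0 (n H i′)

  size-∪ᵥ : ∀ C D → vsSize H (C ∪ᵥ D) ≤ vsSize H C + vsSize H D
  size-∪ᵥ C D = begin
    vsSize H (C ∪ᵥ D)                          ≡⟨ vsSize≡∑ (C ∪ᵥ D) ⟩
    ∑[ i < r ] ∣ C i ∪ D i ∣                   ≤⟨ ∑-mono (λ i → ∣p∪q∣≤∣p∣+∣q∣ (C i) (D i)) ⟩
    ∑[ i < r ] (∣ C i ∣ + ∣ D i ∣)             ≡⟨ ∑-distrib-+ {r} _ _ ⟩
    ∑[ i < r ] ∣ C i ∣ + ∑[ i < r ] ∣ D i ∣    ≡⟨ cong₂ _+_ (vsSize≡∑ C) (vsSize≡∑ D) ⟨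
    vsSize H C + vsSize H D                    ∎
    where open ≤-Reasoning

  size-setOf : ∀ L → vsSize H (setOf L) ≤ length L
  size-setOf [] = ≤-reflexive (begin
    vsSize H (setOf [])         ≡⟨ vsSize≡∑ (setOf []) ⟩
    ∑[ i < r ] ∣ ∅ {n H i} ∣    ≡⟨ sum-cong-≗ (λ i → ∣⊥∣≡0 (n H i)) ⟩
    ∑[ i < r ] 0                ≡⟨ ∑-zero r ⟩
    0                           ∎)
    where open ≡-Reasoning
  size-setOf (x ∷ L) =
    ≤-trans (size-∪ᵥ ⁅ x ⁆ᵥ (setOf L)) (+-mono-≤ (≤-reflexive (size-⁅⁆ᵥ x)) (size-setOf L))

  ∈⁅⁆ᵥ : ∀ i v → v ∈ₛ ⁅ i , v ⁆ᵥ i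
  ∈⁅⁆ᵥ i v with i ≟ᶠ i
  ... | yes refl = x∈⁅x⁆ v
  ... | no  i≢i  = ⊥-elim (i≢i refl)

  setOf-covers : ∀ L → (∀ j → Hits L j) → IsCover H (setOf L)
  setOf-covers L hits j = hit (hits j)
    where
      hit : ∀ {L} → Hits L j → ∃ λ i → edge H j i ∈ₛ setOf L i
      hit {(i , _) ∷ L} (here refl) = i , p⊆p∪q (setOf L i) (∈⁅⁆ᵥ i (edge H j i))
      hit {x ∷ L}       (there h)   with hit h
      ... | i , j∈L = i , q⊆p∪q (⁅ x ⁆ᵥ i) (setOf L i) j∈L

  -- In an intersecting hypergraph, consecutive pairs of edges share a vertex,
  -- so any s edges are hit by ⌈s/2⌉ vertices.
  module Pairing (I : Intersecting H) where

    pairUp : (js : List (Fin (m H))) →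
             Σ (List Vertex) λ L → 2 * length L ≤ suc (length js) × All (Hits L) js
    pairUp [] = [] , z≤n , []
    pairUp (j ∷ []) with I j j
    ... | i , _ = (i , edge H j i) ∷ [] , s≤s (s≤s z≤n) , here refl ∷ []
    pairUp (j ∷ j′ ∷ js) with pairUp js | I j j′
    ... | L , 2|L|≤ , hits | i , common =
      (i , edge H j i) ∷ L ,
      ≤-trans (≤-reflexive (*-suc 2 (length L))) (s≤s (s≤s 2|L|≤)) ,
      here refl ∷ here (sym common) ∷ All.map there hits

    halfCover : ∀ {P : Fin (m H) → Set} (P? : ∀ j → Dec (P j)) →
                Σ (List Vertex) λ L → 2 * length L ≤ suc (count P P?) × (∀ j → P j → Hits L j)
    halfCover {P} P? with pairUp (enumerate P?)
    ... | L , 2|L|≤ , hits =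
      L ,
      subst (λ c → 2 * length L ≤ suc c) (length-enumerate P?) 2|L|≤ ,
      λ j pj → All.lookup hits (∈-enumerate P? j pj)

module DegreeCounting {r} (H : Partite r) where

  meet : Fin (m H) → Fin (m H) → ℕ
  meet j j′ = count (λ i → edge H j i ≡ edge H j′ i) (λ i → edge H j i ≟ᶠ edge H j′ i)

  edgeDeg : Fin (m H) → Fin r → ℕ
  edgeDeg j i = deg H i (edge H j i)

  meet-self : ∀ j → meet j j ≡ r
  meet-self j = count-all _ (λ i → edge H j i ≟ᶠ edge H j i) (λ i → refl)

  edgeDeg≥1 : ∀ j i → 1 ≤ edgeDeg j i
  edgeDeg≥1 j i = count-pos _ (λ j′ → edge H j′ i ≟ᶠ edge H j i) j refl

  ∑deg≡size : ∀ i → ∑[ v < n H i ] deg H i v ≡ m H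
  ∑deg≡size i = begin
    ∑[ v < n H i ] deg H i v         ≡⟨ sum-cong-≗ (λ v → *-identityʳ (deg H i v)) ⟨
    ∑[ v < n H i ] (deg H i v * 1)   ≡⟨ ∑-fibres (λ j → edge H j i) (λ _ → 1) ⟨
    ∑[ j < m H ] 1                   ≡⟨ ∑-const (m H) 1 ⟩
    m H * 1                          ≡⟨ *-identityʳ (m H) ⟩
    m H                              ∎
    where open ≡-Reasoning

  ∑edgeDeg≡∑meet : ∀ j → sum (edgeDeg j) ≡ ∑[ j′ < m H ] meet j j′
  ∑edgeDeg≡∑meet j = begin
    ∑[ i < r ] deg H i (edge H j i)
      ≡⟨ sum-cong-≗ (λ i → count≡∑𝟙 _ (λ j′ → edge H j′ i ≟ᶠ edge H j i)) ⟩
    ∑[ i < r ] ∑[ j′ < m H ] 𝟙 (edge H j′ i ≟ᶠ edge H j i)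
      ≡⟨ ∑-comm (λ i j′ → 𝟙 (edge H j′ i ≟ᶠ edge H j i)) ⟩
    ∑[ j′ < m H ] ∑[ i < r ] 𝟙 (edge H j′ i ≟ᶠ edge H j i)
      ≡⟨ sum-cong-≗ {m H} (λ j′ → sum-cong-≗ {r} (flip j′)) ⟩
    ∑[ j′ < m H ] ∑[ i < r ] 𝟙 (edge H j i ≟ᶠ edge H j′ i)
      ≡⟨ sum-cong-≗ (λ j′ → count≡∑𝟙 _ (λ i → edge H j i ≟ᶠ edge H j′ i)) ⟨
    ∑[ j′ < m H ] meet j j′ ∎
    where
      open ≡-Reasoning
      flip : ∀ j′ i → 𝟙 (edge H j′ i ≟ᶠ edge H j i) ≡ 𝟙 (edge H j i ≟ᶠ edge H j′ i)
      flip j′ i = 𝟙-⇔ sym sym (edge H j′ i ≟ᶠ edge H j i) (edge H j i ≟ᶠ edge H j′ i)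

  ∑∑edgeDeg≡∑∑deg² : ∑[ j < m H ] sum (edgeDeg j) ≡
                     ∑[ i < r ] ∑[ v < n H i ] (deg H i v * deg H i v)
  ∑∑edgeDeg≡∑∑deg² = trans (∑-comm edgeDeg)
    (sum-cong-≗ (λ i → ∑-fibres (λ j → edge H j i) (deg H i)))

module ExtremalCase (k : ℕ) (H : Partite (2 * k + 1)) (I : Intersecting H)
                    (|H|≤r : m H ≤ 2 * k + 1) (τ≥k+1 : CoveringNumberAtLeast H (k + 1)) where

  open VertexLists H
  open Pairing I
  open DegreeCounting H

  hitting≥ : ∀ L → (∀ j → Hits L j) → suc k ≤ length L
  hitting≥ L hits = subst (_≤ length L) (+-comm k 1)
    (≤-trans (τ≥k+1 (setOf L) (setOf-covers L hits)) (size-setOf L))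

  pairCover : Σ (List Vertex) λ L → 2 * length L ≤ suc (m H) × (∀ j → Hits L j)
  pairCover with halfCover {P = λ _ → ⊤} (λ _ → yes tt)
  ... | L , 2|L|≤ , hits =
    L , subst (λ c → 2 * length L ≤ suc c) (count-all _ _ (λ _ → tt)) 2|L|≤ , (λ j → hits j tt)

  -- |H| ≥ 2k+1, since the ⌈|H|/2⌉ vertices of pairCover cover H
  size≡r : m H ≡ 2 * k + 1
  size≡r with pairCover
  ... | L , 2|L|≤ , hits = ≤-antisym |H|≤r (≤-pred (begin
    suc (2 * k + 1)   ≡⟨ double-suc k ⟩
    2 * suc k         ≤⟨ *-monoʳ-≤ 2 (hitting≥ L hits) ⟩
    2 * length L      ≤⟨ 2|L|≤ ⟩
    suc (m H)         ∎))
    where open ≤-Reasoning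

  -- and then pairCover is a cover of size k+1
  τ≡k+1 : CoveringNumber H (k + 1)
  τ≡k+1 with pairCover
  ... | L , 2|L|≤ , hits =
    (setOf L , covers , ≤-antisym size≤ (τ≥k+1 (setOf L) covers)) , τ≥k+1
    where
      open ≤-Reasoning
      covers = setOf-covers L hits
      |L|≤ : length L ≤ suc k
      |L|≤ = *-cancelˡ-≤ 2 (begin
        2 * length L      ≤⟨ 2|L|≤ ⟩
        suc (m H)         ≡⟨ cong suc size≡r ⟩
        suc (2 * k + 1)   ≡⟨ double-suc k ⟩
        2 * suc k         ∎)
      size≤ : vsSize H (setOf L) ≤ k + 1
      size≤ = ≤-trans (size-setOf L) (subst (length L ≤_) (+-comm 1 k) |L|≤)

  avoiding : (i : Fin (2 * k + 1)) → Fin (n H i) → ℕ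
  avoiding i v = count (λ j → ¬ edge H j i ≡ v) (λ j → ¬? (edge H j i ≟ᶠ v))

  -- v together with a half-cover of the edges avoiding v hits every edge
  2k≤avoiding : ∀ i v → 2 * k ≤ suc (avoiding i v)
  2k≤avoiding i v with halfCover (λ j → ¬? (edge H j i ≟ᶠ v))
  ... | L , 2|L|≤ , hitsAvoiding =
    ≤-trans (*-monoʳ-≤ 2 (≤-pred (hitting≥ ((i , v) ∷ L) hitsAll))) 2|L|≤
    where
      hitsAll : ∀ j → Hits ((i , v) ∷ L) j
      hitsAll j with edge H j i ≟ᶠ v
      ... | yes j∋v = here j∋v
      ... | no  j∌v = there (hitsAvoiding j j∌v)

  deg≤2 : ∀ i v → deg H i v ≤ 2
  deg≤2 i v = +-cancelʳ-≤ (avoiding i v) (deg H i v) 2 (begin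
    deg H i v + avoiding i v   ≡⟨ count-compl _ (λ j → edge H j i ≟ᶠ v) ⟩
    m H                        ≤⟨ |H|≤r ⟩
    2 * k + 1                  ≤⟨ +-monoˡ-≤ 1 (2k≤avoiding i v) ⟩
    suc (avoiding i v) + 1     ≡⟨ +-comm (suc (avoiding i v)) 1 ⟩
    2 + avoiding i v           ∎)
    where open ≤-Reasoning

  -- the common value 4k+1 of both sides of the double count, per term
  T : ℕ
  T = (2 * k + 1) + 2 * k

  meetLower : Fin (m H) → Fin (m H) → ℕ
  meetLower j j′ = 1 + 𝟙 (j ≟ᶠ j′) * (2 * k)

  meet≥ : ∀ j j′ → meetLower j j′ ≤ meet j j′
  meet≥ j j′ with j ≟ᶠ j′
  ... | yes refl =
    ≤-reflexive (trans (cong suc (*-identityˡ (2 * k))) (trans (+-comm 1 (2 * k)) (sym (meet-self j))))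
  ... | no _ with I j j′
  ...   | i , common = count-pos _ (λ i → edge H j i ≟ᶠ edge H j′ i) i common

  ∑meetLower : ∀ j → ∑[ j′ < m H ] meetLower j j′ ≡ T
  ∑meetLower j = begin
    ∑[ j′ < m H ] (1 + 𝟙 (j ≟ᶠ j′) * (2 * k))
      ≡⟨ ∑-distrib-+ {m H} _ _ ⟩
    ∑[ j′ < m H ] 1 + ∑[ j′ < m H ] (𝟙 (j ≟ᶠ j′) * (2 * k))
      ≡⟨ cong₂ _+_ (∑-const (m H) 1) (∑-select j (λ _ → 2 * k)) ⟩
    m H * 1 + 2 * k
      ≡⟨ cong (_+ 2 * k) (trans (*-identityʳ (m H)) size≡r) ⟩
    T ∎
    where open ≡-Reasoning

  edgeSum≥T : ∀ j → T ≤ sum (edgeDeg j)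
  edgeSum≥T j = begin
    T                              ≡⟨ ∑meetLower j ⟨
    ∑[ j′ < m H ] meetLower j j′   ≤⟨ ∑-mono (meet≥ j) ⟩
    ∑[ j′ < m H ] meet j j′        ≡⟨ ∑edgeDeg≡∑meet j ⟨
    sum (edgeDeg j)                ∎
    where open ≤-Reasoning

  sideSum : ∀ i → fibreSize (deg H i) 1 + 2 * fibreSize (deg H i) 2 ≡ 2 * k + 1
  sideSum i = trans (sym ∑-values) (trans (∑deg≡size i) size≡r)
    where open ValuesUpTo2 (deg H i) (deg≤2 i)

  sideSquares : ∀ i → ∑[ v < n H i ] (deg H i v * deg H i v) ≡
                      (2 * k + 1) + 2 * fibreSize (deg H i) 2
  sideSquares i =
    trans ∑-squares (cong (_+ 2 * fibreSize (deg H i) 2) (trans (∑deg≡size i) size≡r))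
    where open ValuesUpTo2 (deg H i) (deg≤2 i)

  -- #2 ≤ k because 2·#2 ≤ 2k+1, so Σ d² ≤ T on every side
  sideSquares≤T : ∀ i → ∑[ v < n H i ] (deg H i v * deg H i v) ≤ T
  sideSquares≤T i = ≤-trans (≤-reflexive (sideSquares i))
    (+-monoʳ-≤ (2 * k + 1) (*-monoʳ-≤ 2 (half≤ (fibreSize (deg H i) 2) k
      (≤-trans (m≤n+m _ (fibreSize (deg H i) 1)) (≤-reflexive (sideSum i))))))

  -- Σ_e Σ_{v∈e} d(v) = Σ_i Σ_v d(v)², with r terms ≥ T on the left and r terms
  -- ≤ T on the right: all of them equal T
  tight : (∀ j → sum (edgeDeg j) ≡ T) × (∀ i → ∑[ v < n H i ] (deg H i v * deg H i v) ≡ T)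
  tight = ∑-squeeze size≡r edgeSum≥T sideSquares≤T ∑∑edgeDeg≡∑∑deg²

  sideProfile : ∀ i → fibreSize (deg H i) 1 ≡ 1 × fibreSize (deg H i) 2 ≡ k
  sideProfile i = side-arith k _ _ (sideSum i) (trans (sym (sideSquares i)) (proj₂ tight i))

  edgeProfile : ∀ j → fibreSize (edgeDeg j) 1 ≡ 1 × fibreSize (edgeDeg j) 2 ≡ 2 * k
  edgeProfile j =
    edge-arith k _ _ (values-cover (edgeDeg≥1 j)) (trans (sym ∑-values) (proj₁ tight j))
    where open ValuesUpTo2 (edgeDeg j) (λ i → deg≤2 i (edge H j i))

  -- Σ_f |e ∩ f| equals the sum of the lower bounds, so each bound is attained
  linear : Linear H
  linear j j′ j≢j′ = begin
    meet j j′                    ≡⟨ ∑-tight (meet≥ j) ∑meet≤ j′ ⟨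
    1 + 𝟙 (j ≟ᶠ j′) * (2 * k)    ≡⟨ cong (λ c → 1 + c * (2 * k)) (𝟙-no (j ≟ᶠ j′) j≢j′) ⟩
    1                            ∎
    where
      open ≡-Reasoning
      ∑meet≤ : ∑[ j′ < m H ] meet j j′ ≤ ∑[ j′ < m H ] meetLower j j′
      ∑meet≤ = ≤-reflexive
        (trans (sym (∑edgeDeg≡∑meet j)) (trans (proj₁ tight j) (sym (∑meetLower j))))

lemma6 : (r k : ℕ) → r ≡ 2 * k + 1 →
    (H : Partite r) → Intersecting H → size H ≤ r →
    CoveringNumberAtLeast H (k + 1) →
      (size H ≡ r)
    × CoveringNumber H (k + 1)
    × (∀ (i : Fin r) →
           count (λ v → deg H i v ≡ 1) (λ v → deg H i v Data.Nat.≟ 1) ≡ 1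
         × count (λ v → deg H i v ≡ 2) (λ v → deg H i v Data.Nat.≟ 2) ≡ k
         × (∀ v → deg H i v ≥ 1 → deg H i v ≡ 1 ⊎ deg H i v ≡ 2))
    × (∀ (j : Fin (size H)) →
           count (λ i → deg H i (edge H j i) ≡ 1)
                 (λ i → deg H i (edge H j i) Data.Nat.≟ 1) ≡ 1
         × count (λ i → deg H i (edge H j i) ≡ 2)
                 (λ i → deg H i (edge H j i) Data.Nat.≟ 2) ≡ 2 * k)
    × Linear H
lemma6 r k refl H I |H|≤r τ≥k+1 =
    size≡r
  , τ≡k+1
  , (λ i → proj₁ (sideProfile i) , proj₂ (sideProfile i) ,
           λ v d≥1 → between-1-2 d≥1 (deg≤2 i v))
  , edgeProfile
  , linear
  where open ExtremalCase k H I |H|≤r τ≥k+1
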